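{- For any finite connected graph $G$, there exists a spanning tree $T$ of $G$ such that $\gamma_{gr}(G)\le\gamma_{gr}(T)$.
   Context: For a graph $G$, a sequence of vertices $S=(v_1,\dots,v_k)$ is a legal sequence if for every $i\in[k]$, $N[v_i]\setminus\bigcup_{j=1}^{i-1}N[v_j]\neq\emptyset$ ($N[v]$ the closed neighborhood). The Grundy domination number $\gamma_{gr}(G)$ is the maximum length of a legal sequence of $G$. -}

module Defs where

open import Data.Nat using (ℕ; _≤_)
open import Data.Fin using (Fin)
open import Data.Bool using (Bool; true)
open import Data.List using (List; []; _∷_; _++_; length)
open import Data.List.Relation.Unary.All using (All)
open import Data.List.Relation.Unary.Unique.Propositional using (Unique)
open import Data.Product using (Σ; _×_; ∃)
open import Data.Sum using (_⊎_)
open import Relation.Binary.PropositionalEquality using (_≡_)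
open import Relation.Nullary using (¬_)

record Graph (n : ℕ) : Set where
  field
    adj    : Fin n → Fin n → Bool
    sym    : ∀ u v → adj u v ≡ adj v u
    irrefl : ∀ v → ¬ (adj v v ≡ true)
open Graph public

Adj : ∀ {n} → Graph n → Fin n → Fin n → Set
Adj G u v = adj G u v ≡ true

data Walk {n} (G : Graph n) : Fin n → Fin n → Set where
  here : ∀ {v} → Walk G v v
  step : ∀ {u w v} → Adj G u w → Walk G w v → Walk G u v

Connected : ∀ {n} → Graph n → Set
Connected G = ∀ u v → Walk G u v

data PathFrom {n} (G : Graph n) : Fin n → List (Fin n) → Fin n → Set where
  end  : ∀ {x} → PathFrom G x [] x
  cons : ∀ {x y ys z} → Adj G x y → PathFrom G y ys z → PathFrom G x (y ∷ ys) z

-- A cycle: distinct vertices v0, v1, ..., vk with k ≥ 2, consecutive ones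
-- adjacent and vk adjacent to v0.
record Cycle {n} (G : Graph n) : Set where
  field
    v0 v1 v2 : Fin n
    rest     : List (Fin n)
    last     : Fin n
    path     : PathFrom G v0 (v1 ∷ v2 ∷ rest) last
    closing  : Adj G last v0
    distinct : Unique (v0 ∷ v1 ∷ v2 ∷ rest)

Acyclic : ∀ {n} → Graph n → Set
Acyclic G = ¬ Cycle G

IsTree : ∀ {n} → Graph n → Set
IsTree T = Connected T × Acyclic T

SubgraphOf : ∀ {n} → Graph n → Graph n → Set
SubgraphOf T G = ∀ u v → Adj T u v → Adj G u v

IsSpanningTree : ∀ {n} → Graph n → Graph n → Set
IsSpanningTree T G = SubgraphOf T G × IsTree T

InClosedNbhd : ∀ {n} → Graph n → Fin n → Fin n → Set
InClosedNbhd G v w = (w ≡ v) ⊎ Adj G v w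

-- LegalFrom G prev S : S can be appended to the already chosen sequence prev
-- (each new vertex footprints some vertex not in the closed nbhd of any earlier one)
data LegalFrom {n} (G : Graph n) : List (Fin n) → List (Fin n) → Set where
  done : ∀ {prev} → LegalFrom G prev []
  next : ∀ {prev v S} →
         (∃ λ w → InClosedNbhd G v w × All (λ u → ¬ InClosedNbhd G u w) prev) →
         LegalFrom G (prev ++ (v ∷ [])) S →
         LegalFrom G prev (v ∷ S)

Legal : ∀ {n} → Graph n → List (Fin n) → Set
Legal G S = LegalFrom G [] S

IsGrundyDominationNumber : ∀ {n} → Graph n → ℕ → Set
IsGrundyDominationNumber G k =
  (∃ λ S → Legal G S × length S ≡ k) × (∀ S → Legal G S → length S ≤ k)

-- Take a legal sequence v₁, …, v_k of G of maximum length (it exists because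
-- the footprints wᵢ ∈ N[vᵢ] ∖ ⋃_{j<i} N[vⱼ] are distinct, so k ≤ |V(G)|).
-- When vᵢwᵢ is considered, wᵢ lies outside every earlier N[vⱼ], hence is not
-- an endpoint of any earlier edge vⱼwⱼ; so these edges form a forest of G,
-- which Kruskal's procedure extends to a spanning tree T.  Every vᵢ still
-- footprints wᵢ in T, and T dominates nothing that G does not, so the sequence
-- stays legal in T.

module Submission where

open import Defs
open import Data.Nat using (ℕ; zero; suc; _≤_)
open import Data.Nat.Properties using (≤∧≢⇒<; m<1+n⇒m≤n; suc-injective; module ≤-Reasoning)
open import Data.Fin using (Fin; zero; suc; _≟_)
open import Data.Fin.Properties using (any?; injective⇒≤)
open import Data.Bool using (true; false; _∨_; if_then_else_)
open import Data.Bool.Properties as Bool using (∨-zeroʳ)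
open import Data.List using (List; []; _∷_; _++_; length; lookup; allFin; cartesianProduct)
open import Data.List.Relation.Unary.All as All using (All; []; _∷_; all?)
open import Data.List.Relation.Unary.All.Properties using (All¬⇒¬Any; ++⁻ˡ; ++⁻ʳ)
open import Data.List.Relation.Unary.Any using (Any; here; there)
open import Data.List.Relation.Unary.Any.Properties using (++⁺ˡ; ++⁺ʳ)
open import Data.List.Relation.Unary.AllPairs using ([]; _∷_)
open import Data.List.Relation.Unary.Unique.Propositional using (Unique)
open import Data.List.Membership.Propositional using (_∈_)
open import Data.List.Membership.Propositional.Properties using (∈-lookup; ∈-allFin; ∈-cartesianProduct⁺)
open import Data.Product using (Σ; ∃; _×_; _,_; proj₁)
open import Data.Sum using (_⊎_; inj₁; inj₂)
open import Data.Empty using (⊥-elim)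
open import Function.Bundles using (mk⇔)
open import Function.Definitions using (Injective)
open import Relation.Nullary using (¬_; Dec; yes; no; does)
open import Relation.Nullary.Decidable using (_×-dec_; _⊎-dec_; ¬?; map′; dec-true; does-⇔)
open import Relation.Unary using (Decidable)
open import Relation.Binary.PropositionalEquality as ≡ using (_≡_; _≢_; refl; cong; cong₂; subst; trans)

adj-sym : ∀ {n} (H : Graph n) {x y} → Adj H x y → Adj H y x
adj-sym H {x} {y} e = trans (sym H y x) e

_++ʷ_ : ∀ {n} {H : Graph n} {x y z} → Walk H x y → Walk H y z → Walk H x z
here     ++ʷ q = q
step e p ++ʷ q = step e (p ++ʷ q)

reverseʷ : ∀ {n} {H : Graph n} {x y} → Walk H x y → Walk H y x
reverseʷ here                 = here
reverseʷ {H = H} (step e p) = reverseʷ p ++ʷ step (adj-sym H e) here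

walk-along : ∀ {n} {H H′ : Graph n} → (∀ {x y} → Adj H x y → Walk H′ x y) →
             ∀ {x y} → Walk H x y → Walk H′ x y
walk-along f here       = here
walk-along f (step e p) = f e ++ʷ walk-along f p

mapʷ : ∀ {n} {H H′ : Graph n} → SubgraphOf H H′ → ∀ {x y} → Walk H x y → Walk H′ x y
mapʷ H⊆H′ = walk-along λ {x} {y} e → step (H⊆H′ x y e) here

isolated-walk : ∀ {n} {H : Graph n} {x y} → (∀ {z} → ¬ Adj H x z) → Walk H x y → x ≡ y
isolated-walk isolated here       = refl
isolated-walk isolated (step e p) = ⊥-elim (isolated e)

pathFrom⇒walk : ∀ {n} {H : Graph n} {x ys z} → PathFrom H x ys z → Walk H x z
pathFrom⇒walk end        = here
pathFrom⇒walk (cons e p) = step e (pathFrom⇒walk p)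

pathFrom-end∈ : ∀ {n} {H : Graph n} {x ys z} → PathFrom H x ys z → z ∈ x ∷ ys
pathFrom-end∈ end        = here refl
pathFrom-end∈ (cons e p) = there (pathFrom-end∈ p)

InClosedNbhd-mono : ∀ {n} {H H′ : Graph n} → SubgraphOf H H′ →
                    ∀ {v w} → InClosedNbhd H v w → InClosedNbhd H′ v w
InClosedNbhd-mono H⊆H′ (inj₁ w≡v)       = inj₁ w≡v
InClosedNbhd-mono H⊆H′ {v} {w} (inj₂ e) = inj₂ (H⊆H′ v w e)

module _ {n} (u v : Fin n) where

  Joins : Fin n → Fin n → Set
  Joins x y = (x ≡ u × y ≡ v) ⊎ (x ≡ v × y ≡ u)

  Endpoint : Fin n → Set
  Endpoint w = w ≡ u ⊎ w ≡ v

  joins? : ∀ x y → Dec (Joins x y)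
  joins? x y = (x ≟ u ×-dec y ≟ v) ⊎-dec (x ≟ v ×-dec y ≟ u)

  joins-swap : ∀ {x y} → Joins x y → Joins y x
  joins-swap (inj₁ (x≡u , y≡v)) = inj₂ (y≡v , x≡u)
  joins-swap (inj₂ (x≡v , y≡u)) = inj₁ (y≡u , x≡v)

  joins⇒endpoint : ∀ {x y} → Joins x y → Endpoint x
  joins⇒endpoint (inj₁ (x≡u , _)) = inj₁ x≡u
  joins⇒endpoint (inj₂ (x≡v , _)) = inj₂ x≡v

  joins-contains-endpoint : ∀ {x y w} → Joins x y → Endpoint w → x ≡ w ⊎ y ≡ w
  joins-contains-endpoint (inj₁ (refl , refl)) (inj₁ refl) = inj₁ refl
  joins-contains-endpoint (inj₁ (refl , refl)) (inj₂ refl) = inj₂ refl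
  joins-contains-endpoint (inj₂ (refl , refl)) (inj₁ refl) = inj₂ refl
  joins-contains-endpoint (inj₂ (refl , refl)) (inj₂ refl) = inj₁ refl

  joins-unique : ∀ {x y z} → Joins x y → Joins x z → y ≡ z
  joins-unique (inj₁ (refl , refl)) (inj₁ (_ , refl))    = refl
  joins-unique (inj₁ (refl , refl)) (inj₂ (refl , refl)) = refl
  joins-unique (inj₂ (refl , refl)) (inj₁ (refl , refl)) = refl
  joins-unique (inj₂ (refl , refl)) (inj₂ (_ , refl))    = refl

∨-does-true : ∀ {b} {A : Set} (a? : Dec A) → (b ∨ does a?) ≡ true → b ≡ true ⊎ A
∨-does-true {true}  _       _  = inj₁ refl
∨-does-true {false} (yes a) _  = inj₂ a
∨-does-true {false} (no _)  ()

addEdge : ∀ {n} (H : Graph n) (u v : Fin n) → u ≢ v → Graph n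
addEdge H u v u≢v = record
  { adj    = λ x y → adj H x y ∨ does (joins? u v x y)
  ; sym    = λ x y → cong₂ _∨_ (sym H x y)
                         (does-⇔ (mk⇔ (joins-swap u v) (joins-swap u v)) (joins? u v x y) (joins? u v y x))
  ; irrefl = λ x e → loopless x (∨-does-true (joins? u v x x) e)
  }
  where
  loopless : ∀ x → ¬ (Adj H x x ⊎ Joins u v x x)
  loopless x (inj₁ loop)               = irrefl H x loop
  loopless x (inj₂ (inj₁ (refl , refl))) = u≢v refl
  loopless x (inj₂ (inj₂ (refl , refl))) = u≢v refl

module AddEdge {n} (H : Graph n) {u v : Fin n} (u≢v : u ≢ v) where

  H⁺ : Graph n
  H⁺ = addEdge H u v u≢v

  old : SubgraphOf H H⁺
  old x y e rewrite e = refl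

  new : Adj H⁺ u v
  new = trans (cong (adj H u v ∨_) (dec-true (joins? u v u v) (inj₁ (refl , refl))))
              (∨-zeroʳ (adj H u v))

  split : ∀ {x y} → Adj H⁺ x y → Adj H x y ⊎ Joins u v x y
  split {x} {y} = ∨-does-true (joins? u v x y)

  pathFrom-avoiding : ∀ {w x ys z} → Endpoint u v w → All (w ≢_) (x ∷ ys) →
                      PathFrom H⁺ x ys z → PathFrom H x ys z
  pathFrom-avoiding w∈uv avoid end = end
  pathFrom-avoiding w∈uv (w≢x ∷ avoid) (cons e p) with split e
  ... | inj₁ e′ = cons e′ (pathFrom-avoiding w∈uv avoid p)
  ... | inj₂ j with joins-contains-endpoint u v j w∈uv
  ...   | inj₁ x≡w = ⊥-elim (w≢x (≡.sym x≡w))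
  ...   | inj₂ y≡w = ⊥-elim (All.head avoid (≡.sym y≡w))

  module _ (disconnected : ¬ Walk H u v) where

    joins-disconnected : ∀ {x y} → Joins u v x y → ¬ Walk H x y
    joins-disconnected (inj₁ (refl , refl)) p = disconnected p
    joins-disconnected (inj₂ (refl , refl)) p = disconnected (reverseʷ p)

    -- Were the new edge xy on the path, the rest of the path (which avoids x)
    -- followed by the walk back from z would reconnect y to x inside H.
    pathFrom-closed : ∀ {x ys z} → Walk H z x → PathFrom H⁺ x ys z → Unique (x ∷ ys) →
                      PathFrom H x ys z
    pathFrom-closed back end _ = end
    pathFrom-closed back (cons e p) (x∉ys ∷ distinct) with split e
    ... | inj₁ e′ = cons e′ (pathFrom-closed (back ++ʷ step e′ here) p distinct)
    ... | inj₂ j  = ⊥-elim (joins-disconnected (joins-swap u v j) (rest ++ʷ back))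
      where rest = pathFrom⇒walk (pathFrom-avoiding (joins⇒endpoint u v j) x∉ys p)

    -- If the closing edge la is the new one, the first edge ab cannot be new
    -- (b would equal l), and the path from b to l avoids the endpoint a; so it
    -- joins a to l inside H.
    acyclic⁺ : Acyclic H → Acyclic H⁺
    acyclic⁺ acyclicH record { path = path ; closing = closing ; distinct = distinct }
      with split closing
    ... | inj₁ closing′ = acyclicH record
      { path = pathFrom-closed (step closing′ here) path distinct ; closing = closing′ ; distinct = distinct }
    acyclic⁺ acyclicH record { path = cons e p ; distinct = a∉ ∷ b∉ ∷ _ } | inj₂ la
      with split e | p
    ... | inj₁ ab | _ = joins-disconnected la (reverseʷ (step ab (pathFrom⇒walk b⋯l)))
      where b⋯l = pathFrom-avoiding (joins⇒endpoint u v (joins-swap u v la)) a∉ p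
    ... | inj₂ ab | cons _ c⋯l =
      All.lookup b∉ (pathFrom-end∈ c⋯l) (≡.sym (joins-unique u v (joins-swap u v la) ab))

-- Labelled forests

record LabelledForest {n} (G : Graph n) : Set where
  field
    graph      : Graph n
    label      : Fin n → Fin n
    acyclic    : Acyclic graph
    ⊆G         : SubgraphOf graph G
    label-adj  : ∀ {x y} → Adj graph x y → label x ≡ label y
    label-walk : ∀ {x y} → label x ≡ label y → Walk graph x y

  walk⇒label : ∀ {x y} → Walk graph x y → label x ≡ label y
  walk⇒label here       = refl
  walk⇒label (step e p) = trans (label-adj e) (walk⇒label p)

open LabelledForest

edgeless : ∀ {n} → Graph n
edgeless = record { adj = λ _ _ → false ; sym = λ _ _ → refl ; irrefl = λ _ () }

edgeless-acyclic : ∀ {n} → Acyclic (edgeless {n})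
edgeless-acyclic record { path = cons () _ }

emptyForest : ∀ {n} (G : Graph n) → LabelledForest G
emptyForest G = record
  { graph      = edgeless
  ; label      = λ x → x
  ; acyclic    = edgeless-acyclic
  ; ⊆G         = λ _ _ ()
  ; label-adj  = λ ()
  ; label-walk = λ { refl → here }
  }

merge : ∀ {n} → Fin n → Fin n → Fin n → Fin n
merge a b c = if does (c ≟ b) then a else c

merge-target : ∀ {n} (a b : Fin n) → merge a b b ≡ a
merge-target a b with b ≟ b
... | yes _  = refl
... | no b≢b = ⊥-elim (b≢b refl)

merge-other : ∀ {n} (a b c : Fin n) → c ≢ b → merge a b c ≡ c
merge-other a b c c≢b with c ≟ b
... | yes c≡b = ⊥-elim (c≢b c≡b)
... | no _    = refl

module _ {n} {G : Graph n} (F : LabelledForest G) {u v : Fin n}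
         (uv : Adj G u v) (apart : label F u ≢ label F v) where

  private
    u≢v : u ≢ v
    u≢v refl = apart refl

    open AddEdge (graph F) u≢v

    lu = label F u
    lv = label F v

    label⁺ : Fin n → Fin n
    label⁺ x = merge lu lv (label F x)

    label⁺-adj : ∀ {x y} → Adj H⁺ x y → label⁺ x ≡ label⁺ y
    label⁺-adj e with split e
    ... | inj₁ e′                   = cong (merge lu lv) (label-adj F e′)
    ... | inj₂ (inj₁ (refl , refl)) = trans (merge-other lu lv lu apart) (≡.sym (merge-target lu lv))
    ... | inj₂ (inj₂ (refl , refl)) = trans (merge-target lu lv) (≡.sym (merge-other lu lv lu apart))

    walkᶠ : ∀ {x y} → label F x ≡ label F y → Walk H⁺ x y
    walkᶠ same = mapʷ old (label-walk F same)

    label⁺-walk : ∀ {x y} → label⁺ x ≡ label⁺ y → Walk H⁺ x y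
    label⁺-walk {x} {y} same with label F x ≟ lv | label F y ≟ lv
    ... | yes x~v | yes y~v = walkᶠ (trans x~v (≡.sym y~v))
    ... | yes x~v | no _    = walkᶠ x~v ++ʷ step (adj-sym H⁺ new) (walkᶠ same)
    ... | no _    | yes y~v = walkᶠ same ++ʷ step new (walkᶠ (≡.sym y~v))
    ... | no _    | no _    = walkᶠ same

    ⊆G⁺ : SubgraphOf H⁺ G
    ⊆G⁺ x y e with split e
    ... | inj₁ e′                   = ⊆G F x y e′
    ... | inj₂ (inj₁ (refl , refl)) = uv
    ... | inj₂ (inj₂ (refl , refl)) = adj-sym G uv

  insertEdge : Σ (LabelledForest G) λ F′ →
                 SubgraphOf (graph F) (graph F′) × Adj (graph F′) u v ×
                 (∀ {x y} → Adj (graph F′) x y → Adj (graph F) x y ⊎ Joins u v x y)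
  insertEdge = F⁺ , old , new , split
    where
    F⁺ : LabelledForest G
    F⁺ = record
      { graph      = H⁺
      ; label      = label⁺
      ; acyclic    = acyclic⁺ (λ p → apart (walk⇒label F p)) (acyclic F)
      ; ⊆G         = ⊆G⁺
      ; label-adj  = label⁺-adj
      ; label-walk = label⁺-walk
      }

module _ {n} {G : Graph n} where

  connectPair : (F : LabelledForest G) (u v : Fin n) →
    Σ (LabelledForest G) λ F′ → SubgraphOf (graph F) (graph F′) × (Adj G u v → Walk (graph F′) u v)
  connectPair F u v with label F u ≟ label F v | adj G u v in uv
  ... | yes same | _     = F , (λ _ _ e → e) , λ _ → label-walk F same
  ... | no apart | false = F , (λ _ _ e → e) , λ ()
  ... | no apart | true  = let F′ , F⊆F′ , new , _ = insertEdge F uv apart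
                           in F′ , F⊆F′ , λ _ → step new here

  connectPairs : (F : LabelledForest G) (ps : List (Fin n × Fin n)) →
    Σ (LabelledForest G) λ F′ → SubgraphOf (graph F) (graph F′) ×
      (∀ {u v} → (u , v) ∈ ps → Adj G u v → Walk (graph F′) u v)
  connectPairs F []             = F , (λ _ _ e → e) , λ ()
  connectPairs F ((u , v) ∷ ps) =
    let F₁ , F⊆F₁ , uv-walk  = connectPair F u v
        F₂ , F₁⊆F₂ , ps-walk = connectPairs F₁ ps
    in F₂ , (λ x y e → F₁⊆F₂ x y (F⊆F₁ x y e))
          , λ { (here refl) e → mapʷ F₁⊆F₂ (uv-walk e) ; (there m) e → ps-walk m e }

  spanningTree-extending : Connected G → (F : LabelledForest G) →
    Σ (Graph n) λ T → IsSpanningTree T G × SubgraphOf (graph F) T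
  spanningTree-extending connected F with connectPairs F (cartesianProduct (allFin n) (allFin n))
  ... | F′ , F⊆F′ , pair-walk =
    graph F′ , (⊆G F′ , (λ x y → walk-along edge-walk (connected x y)) , acyclic F′) , F⊆F′
    where
    edge-walk : ∀ {x y} → Adj G x y → Walk (graph F′) x y
    edge-walk {x} {y} = pair-walk (∈-cartesianProduct⁺ (∈-allFin x) (∈-allFin y))

-- Footprints of a legal sequence

module _ {n} (G : Graph n) where

  Dominated : List (Fin n) → Fin n → Set
  Dominated prev w = Any (λ u → InClosedNbhd G u w) prev

  Undominated : List (Fin n) → Fin n → Set
  Undominated prev w = All (λ u → ¬ InClosedNbhd G u w) prev

  Footprint : List (Fin n) → Fin n → Set
  Footprint prev v = ∃ λ w → InClosedNbhd G v w × Undominated prev w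

  EdgesDominated : List (Fin n) → Graph n → Set
  EdgesDominated prev H = ∀ {x y} → Adj H x y → Dominated prev x

  -- An undominated footprint w is isolated in F, so the edge vw joins two
  -- components of F.
  addFootprint : ∀ {prev v w} (F : LabelledForest G) → EdgesDominated prev (graph F) →
    InClosedNbhd G v w → Undominated prev w →
    Σ (LabelledForest G) λ F′ → SubgraphOf (graph F) (graph F′) ×
      InClosedNbhd (graph F′) v w × EdgesDominated (prev ++ v ∷ []) (graph F′)
  addFootprint F dom (inj₁ w≡v) _ = F , (λ _ _ e → e) , inj₁ w≡v , λ e → ++⁺ˡ (dom e)
  addFootprint {prev} {v} {w} F dom (inj₂ vw) undominated with label F v ≟ label F w
  ... | yes same = ⊥-elim (irrefl G v (subst (Adj G v) w≡v vw))
    where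
    w≡v : w ≡ v
    w≡v = isolated-walk (λ e → All¬⇒¬Any undominated (dom e)) (label-walk F (≡.sym same))
  ... | no apart with insertEdge F vw apart
  ...   | F′ , F⊆F′ , new , split′ = F′ , F⊆F′ , inj₂ new , dom′
    where
    dominated-by-v : ∀ {x} → Endpoint v w x → InClosedNbhd G v x
    dominated-by-v (inj₁ x≡v)  = inj₁ x≡v
    dominated-by-v (inj₂ refl) = inj₂ vw

    dom′ : EdgesDominated (prev ++ v ∷ []) (graph F′)
    dom′ e with split′ e
    ... | inj₁ e′ = ++⁺ˡ (dom e′)
    ... | inj₂ j  = ++⁺ʳ prev (here (dominated-by-v (joins⇒endpoint v w j)))

  footprintForest : ∀ {prev S} (F : LabelledForest G) → EdgesDominated prev (graph F) →
    LegalFrom G prev S →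
    Σ (LabelledForest G) λ F′ → SubgraphOf (graph F) (graph F′) ×
      (∀ T → SubgraphOf (graph F′) T → SubgraphOf T G → LegalFrom T prev S)
  footprintForest F dom done = F , (λ _ _ e → e) , λ _ _ _ → done
  footprintForest F dom (next (w , vw , undominated) L) =
    let F₁ , F⊆F₁ , vw₁ , dom₁ = addFootprint F dom vw undominated
        F₂ , F₁⊆F₂ , legal     = footprintForest F₁ dom₁ L
    in F₂ , (λ x y e → F₁⊆F₂ x y (F⊆F₁ x y e)) , λ T F₂⊆T T⊆G →
         next (w , InClosedNbhd-mono {H = graph F₁} {T} (λ x y e → F₂⊆T x y (F₁⊆F₂ x y e)) vw₁
                 , All.map (λ ¬dom dom → ¬dom (InClosedNbhd-mono {H = T} {G} T⊆G dom)) undominated)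
              (legal T F₂⊆T T⊆G)

  spanningTree-keepingLegal : Connected G → ∀ {S} → Legal G S →
    Σ (Graph n) λ T → IsSpanningTree T G × Legal T S
  spanningTree-keepingLegal connected L =
    let F , _ , legal       = footprintForest (emptyForest G) (λ ()) L
        T , spanning , F⊆T = spanningTree-extending connected F
    in T , spanning , legal T F⊆T (proj₁ spanning)

-- Existence of the Grundy domination number

unique-lookup-injective : ∀ {A : Set} {xs : List A} → Unique xs → Injective _≡_ _≡_ (lookup xs)
unique-lookup-injective (_ ∷ _)        {zero}  {zero}  _  = refl
unique-lookup-injective (x∉xs ∷ _)     {zero}  {suc j} eq = ⊥-elim (All.lookup x∉xs (∈-lookup j) eq)
unique-lookup-injective (x∉xs ∷ _)     {suc i} {zero}  eq =
  ⊥-elim (All.lookup x∉xs (∈-lookup i) (≡.sym eq))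
unique-lookup-injective (_ ∷ distinct) {suc i} {suc j} eq =
  cong suc (unique-lookup-injective distinct eq)

unique⇒length≤ : ∀ {n} {xs : List (Fin n)} → Unique xs → length xs ≤ n
unique⇒length≤ distinct = injective⇒≤ (unique-lookup-injective distinct)

bounded-maximum : ∀ {P : ℕ → Set} → Decidable P → P 0 → ∀ b → (∀ m → P m → m ≤ b) →
                  ∃ λ k → P k × (∀ m → P m → m ≤ k)
bounded-maximum P? p₀ zero    bounded = zero , p₀ , bounded
bounded-maximum P? p₀ (suc b) bounded with P? (suc b)
... | yes p = suc b , p , bounded
... | no ¬p = bounded-maximum P? p₀ b λ m pm →
                m<1+n⇒m≤n (≤∧≢⇒< (bounded m pm) λ { refl → ¬p pm })

module _ {n} (G : Graph n) where

  inClosedNbhd? : ∀ v w → Dec (InClosedNbhd G v w)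
  inClosedNbhd? v w = (w ≟ v) ⊎-dec (adj G v w Bool.≟ true)

  footprint? : ∀ prev v → Dec (Footprint G prev v)
  footprint? prev v = any? λ w → inClosedNbhd? v w ×-dec all? (λ u → ¬? (inClosedNbhd? u w)) prev

  LegalOfLength : List (Fin n) → ℕ → Set
  LegalOfLength prev m = ∃ λ S → LegalFrom G prev S × length S ≡ m

  legalOfLength? : ∀ prev m → Dec (LegalOfLength prev m)
  legalOfLength? prev zero    = yes ([] , done , refl)
  legalOfLength? prev (suc m) =
    map′ extend shorten (any? λ v → footprint? prev v ×-dec legalOfLength? (prev ++ v ∷ []) m)
    where
    Extendable = ∃ λ v → Footprint G prev v × LegalOfLength (prev ++ v ∷ []) m

    extend : Extendable → LegalOfLength prev (suc m)
    extend (v , fp , S , L , refl) = v ∷ S , next fp L , refl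

    shorten : LegalOfLength prev (suc m) → Extendable
    shorten (v ∷ S , next fp L , len) = v , fp , S , L , suc-injective len

  -- The footprints are distinct: a later footprint avoids N[v] for every
  -- earlier v, while the footprint of v lies in N[v].
  footprints : ∀ {prev S} → LegalFrom G prev S →
    Σ (List (Fin n)) λ ws → length ws ≡ length S × Unique ws × All (Undominated G prev) ws
  footprints done = [] , refl , [] , []
  footprints {prev} (next {v = v} (w , vw , undominated) L) =
    let ws , len , distinct , undominated′ = footprints L
        w∉ws = All.map (λ und w≡w′ → All.head (++⁻ʳ prev und) (subst (InClosedNbhd G v) w≡w′ vw))
                       undominated′
    in w ∷ ws , cong suc len , w∉ws ∷ distinct , undominated ∷ All.map (++⁻ˡ prev) undominated′

  legal-length≤ : ∀ {S} → Legal G S → length S ≤ n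
  legal-length≤ L = let _ , len , distinct , _ = footprints L
                    in subst (_≤ n) len (unique⇒length≤ distinct)

  grundyDominationNumber : ∃ (IsGrundyDominationNumber G)
  grundyDominationNumber =
    let k , longest , maximal = bounded-maximum (legalOfLength? []) ([] , done , refl) n
                                  λ { m (S , L , refl) → legal-length≤ L }
    in k , longest , λ S L → maximal (length S) (S , L , refl)

theorem5p1 : ∀ (n : ℕ) (G : Graph n) → Connected G →
    Σ (Graph n) λ T → IsSpanningTree T G ×
      (∀ k k′ → IsGrundyDominationNumber G k → IsGrundyDominationNumber T k′ → k ≤ k′)
theorem5p1 n G connected =
  let k₀ , (S₀ , legal₀ , len₀) , maximal₀ = grundyDominationNumber G
      T , spanning , legalT = spanningTree-keepingLegal G connected legal₀
  in T , spanning , λ { k k′ ((S , legal , refl) , _) (_ , maximalT) → begin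
       length S   ≤⟨ maximal₀ S legal ⟩
       k₀         ≡⟨ ≡.sym len₀ ⟩
       length S₀  ≤⟨ maximalT S₀ legalT ⟩
       k′         ∎ }
  where open ≤-Reasoning
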